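{- Let $G=(V,E)$ be a graph and $v\in V$. Define the relation $\prec_v$ on $V$ by $w_1\prec_v w_2$ iff $M_{v,w_2}\subsetneq M_{v,w_1}$. Then $\prec_v$ is a strict weak order.
   Context: A module of $G$ is a non-empty $M\subseteq V$ such that for all $u\in V\setminus M$ and $x,x'\in M$: $\{u,x\}\in E\iff\{u,x'\}\in E$. For $v,w\in V$, $M_{v,w}$ is the intersection of all modules of $G$ containing $v$ and $w$. A strict weak order is an irreflexive, transitive relation for which incomparability (neither $a\prec b$ nor $b\prec a$) is transitive. -}

module Defs where

open import Data.Nat using (ℕ)
open import Data.Fin using (Fin)
open import Data.Bool using (Bool; true; false)
open import Data.Product using (_×_)
open import Data.Fin.Subset using (Subset; _∈_; _∉_; Nonempty)
open import Relation.Binary.PropositionalEquality using (_≡_)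
open import Relation.Nullary using (¬_)
open import Relation.Unary using (Pred; _⊂_)
open import Function.Bundles using (_⇔_)

record Graph : Set where
  field
    n     : ℕ
    adj   : Fin n → Fin n → Bool
    sym   : ∀ x y → adj x y ≡ adj y x
    loopless : ∀ x → adj x x ≡ false

module _ (G : Graph) where
  open Graph G

  Edge : Fin n → Fin n → Set
  Edge u x = adj u x ≡ true

  IsModule : Subset n → Set
  IsModule M = Nonempty M
             × (∀ u → u ∉ M → ∀ x x′ → x ∈ M → x′ ∈ M → (Edge u x ⇔ Edge u x′))

  Mod : Fin n → Fin n → Pred (Fin n) _
  Mod v w x = ∀ (M : Subset n) → IsModule M → v ∈ M → w ∈ M → x ∈ M

  Prec : Fin n → Fin n → Fin n → Set
  Prec v w₁ w₂ = Mod v w₂ ⊂ Mod v w₁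

record IsStrictWeakOrder {A : Set} (_<_ : A → A → Set) : Set where
  field
    irrefl : ∀ a → ¬ (a < a)
    trans  : ∀ a b c → a < b → b < c → a < c
    incomparable-trans : ∀ a b c
      → (¬ (a < b) × ¬ (b < a))
      → (¬ (b < c) × ¬ (c < b))
      → (¬ (a < c) × ¬ (c < a))

module Submission where

-- Write M_x for M_{v,x}. As ≺_v is strict inclusion of these sets, it is irreflexive
-- and transitive, and its incomparability is transitive once ≺_v is negatively
-- transitive. So suppose a ⊀ b and b ⊀ c but M_c ⊊ M_a. Then M_b is ⊆-incomparable
-- with M_a and with M_c; since x ∈ M_w implies M_x ⊆ M_w, this provides modules through
-- v that contain b but not a, resp. not c (their intersection is B′), and ones that
-- contain a, resp. c, but not b (A and C). For a module N through v and c that misses a,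
-- put N′ = N ∩ C; then A ∖ (N′ ⊖ B′) is a module through v and a that misses c,
-- contradicting c ∈ M_a. Hence a ∈ M_c, so M_a ⊆ M_c. The construction rests on two
-- closure properties: P ⊖ Q is a module when P and Q overlap, and P ∖ Q is a module
-- when it is non-empty and Q ⊄ P.

open import Defs
open import Data.Bool using (Bool)
open import Data.Bool.Properties using (⇔→≡)
open import Data.Fin using (Fin)
open import Data.Fin.Subset using (Subset; _∈_; _∉_; Nonempty; _∩_; _∪_; ∁)
open import Data.Fin.Subset.Properties
  using (_∈?_; x∈p∩q⁺; x∈p∩q⁻; x∈p∪q⁺; x∈p∪q⁻; x∉p⇒x∈∁p; x∈∁p⇒x∉p; x∉∁p⇒x∈p)
open import Data.Nat using (ℕ)
open import Data.Product using (Σ; ∃; _×_; _,_; proj₁; proj₂; map₂)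
open import Data.Sum using (_⊎_; inj₁; inj₂; [_,_])
open import Function using (_∘_)
open import Function.Bundles using (_⇔_; mk⇔; Equivalence)
open import Level using (Level)
open import Relation.Binary.PropositionalEquality using (_≡_; sym; trans; module ≡-Reasoning)
open import Relation.Nullary using (¬_; yes; no)
open import Relation.Nullary.Decidable using (decidable-stable)
open import Relation.Unary using (Pred; _⊆_; _⊂_; _⊈_)
open import Relation.Unary.Properties using (⊂-trans; ⊂-irrefl; ≐-refl; ⊂-⊆-trans; ⊆-⊂-trans)

module _ {a ℓ : Level} {A : Set a} {X Y Z : Pred A ℓ} where

  ⊂-incomparable-between : Z ⊂ X → ¬ Y ⊂ X → ¬ Z ⊂ Y → X ⊈ Y × Y ⊈ X × Y ⊈ Z × Z ⊈ Y
  ⊂-incomparable-between Z⊂X Y⊄X Z⊄Y = X⊈Y , Y⊈X , Y⊈Z , Z⊈Y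
    where
    X⊈Y : X ⊈ Y
    X⊈Y X⊆Y = Z⊄Y (⊂-⊆-trans Z⊂X X⊆Y)
    Y⊈Z : Y ⊈ Z
    Y⊈Z Y⊆Z = Y⊄X (⊆-⊂-trans Y⊆Z Z⊂X)
    Y⊈X : Y ⊈ X
    Y⊈X Y⊆X = Y⊄X (Y⊆X , X⊈Y)
    Z⊈Y : Z ⊈ Y
    Z⊈Y Z⊆Y = Z⊄Y (Z⊆Y , Y⊈Z)

infixr 6 _⊖_

_⊖_ : {n : ℕ} → Subset n → Subset n → Subset n
P ⊖ Q = P ∩ ∁ Q ∪ Q ∩ ∁ P

module _ {n : ℕ} where

  private variable
    P Q : Subset n
    x : Fin n

  x∈p∖q⁺ : x ∈ P → x ∉ Q → x ∈ P ∩ ∁ Q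
  x∈p∖q⁺ x∈P x∉Q = x∈p∩q⁺ (x∈P , x∉p⇒x∈∁p x∉Q)

  x∈p∖q⁻ : x ∈ P ∩ ∁ Q → x ∈ P × x ∉ Q
  x∈p∖q⁻ {P = P} {Q = Q} = map₂ x∈∁p⇒x∉p ∘ x∈p∩q⁻ P (∁ Q)

  x∉p∖q⇒x∈q : x ∉ P ∩ ∁ Q → x ∈ P → x ∈ Q
  x∉p∖q⇒x∈q x∉P∖Q x∈P = x∉∁p⇒x∈p (λ x∈∁Q → x∉P∖Q (x∈p∩q⁺ (x∈P , x∈∁Q)))

  x∈p⊖q⁻ : x ∈ P ⊖ Q → (x ∈ P × x ∉ Q) ⊎ (x ∈ Q × x ∉ P)
  x∈p⊖q⁻ {P = P} {Q = Q} x∈P⊖Q with x∈p∪q⁻ (P ∩ ∁ Q) (Q ∩ ∁ P) x∈P⊖Q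
  ... | inj₁ x∈P∖Q = inj₁ (x∈p∖q⁻ x∈P∖Q)
  ... | inj₂ x∈Q∖P = inj₂ (x∈p∖q⁻ x∈Q∖P)

  x∈p⊖q⁺ˡ : x ∈ P → x ∉ Q → x ∈ P ⊖ Q
  x∈p⊖q⁺ˡ x∈P x∉Q = x∈p∪q⁺ (inj₁ (x∈p∖q⁺ x∈P x∉Q))

  x∈p⊖q⁺ʳ : x ∈ Q → x ∉ P → x ∈ P ⊖ Q
  x∈p⊖q⁺ʳ x∈Q x∉P = x∈p∪q⁺ (inj₂ (x∈p∖q⁺ x∈Q x∉P))

  x∉p⊖q⇒x∈p⇔x∈q : x ∉ P ⊖ Q → x ∈ P ⇔ x ∈ Q
  x∉p⊖q⇒x∈p⇔x∈q x∉P⊖Q = mk⇔ (x∉p∖q⇒x∈q (x∉P⊖Q ∘ x∈p∪q⁺ ∘ inj₁))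
                              (x∉p∖q⇒x∈q (x∉P⊖Q ∘ x∈p∪q⁺ ∘ inj₂))

  x∉p⊖q : (x ∈ P × x ∈ Q) ⊎ (x ∉ P × x ∉ Q) → x ∉ P ⊖ Q
  x∉p⊖q both x∈P⊖Q with both | x∈p⊖q⁻ x∈P⊖Q
  ... | inj₁ (_ , x∈Q) | inj₁ (_ , x∉Q) = x∉Q x∈Q
  ... | inj₁ (x∈P , _) | inj₂ (_ , x∉P) = x∉P x∈P
  ... | inj₂ (x∉P , _) | inj₁ (x∈P , _) = x∉P x∈P
  ... | inj₂ (_ , x∉Q) | inj₂ (x∈Q , _) = x∉Q x∈Q

module _ (G : Graph) where
  open Graph G using (n; adj) renaming (sym to adj-sym)
  open ≡-Reasoning

  private variable
    S P Q : Subset n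
    u w x y p q : Fin n

  module-adjʳ : IsModule G S → u ∉ S → x ∈ S → y ∈ S → adj u x ≡ adj u y
  module-adjʳ (_ , splitFree) u∉S x∈S y∈S = ⇔→≡ (splitFree _ u∉S _ _ x∈S y∈S)

  module-adjˡ : IsModule G S → y ∉ S → u ∈ S → w ∈ S → adj u y ≡ adj w y
  module-adjˡ {y = y} {u = u} {w = w} mS y∉S u∈S w∈S = begin
    adj u y ≡⟨ adj-sym u y ⟩
    adj y u ≡⟨ module-adjʳ mS y∉S u∈S w∈S ⟩
    adj y w ≡⟨ adj-sym y w ⟩
    adj w y ∎

  Uniform : Fin n → Subset n → Set
  Uniform u S = Σ Bool λ r → ∀ {y} → y ∈ S → adj u y ≡ r

  uniform⇒isModule : Nonempty S → (∀ {u} → u ∉ S → Uniform u S) → IsModule G S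
  uniform⇒isModule nonempty uniform = nonempty , λ u u∉S y y′ y∈S y′∈S →
    let (_ , sees) = uniform u∉S
        adj≡ = trans (sees y∈S) (sym (sees y′∈S))
    in mk⇔ (trans (sym adj≡)) (trans adj≡)

  ∩-isModule : IsModule G P → IsModule G Q → x ∈ P → x ∈ Q → IsModule G (P ∩ Q)
  ∩-isModule {P} {Q} {x} mP mQ x∈P x∈Q = uniform⇒isModule (x , x∈p∩q⁺ (x∈P , x∈Q)) uniform
    where
    uniform : u ∉ P ∩ Q → Uniform u (P ∩ Q)
    uniform {u} u∉P∩Q with u ∈? P
    ... | yes u∈P = adj u x , λ y∈P∩Q →
      module-adjʳ mQ (λ u∈Q → u∉P∩Q (x∈p∩q⁺ (u∈P , u∈Q))) (proj₂ (x∈p∩q⁻ P Q y∈P∩Q)) x∈Q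
    ... | no u∉P = adj u x , λ y∈P∩Q → module-adjʳ mP u∉P (proj₁ (x∈p∩q⁻ P Q y∈P∩Q)) x∈P

  ∖-isModule : IsModule G P → IsModule G Q → p ∈ P → p ∉ Q → q ∈ Q → q ∉ P → IsModule G (P ∩ ∁ Q)
  ∖-isModule {P} {Q} {p} {q} mP mQ p∈P p∉Q q∈Q q∉P = uniform⇒isModule (p , x∈p∖q⁺ p∈P p∉Q) uniform
    where
    uniform : u ∉ P ∩ ∁ Q → Uniform u (P ∩ ∁ Q)
    uniform {u} u∉P∖Q with u ∈? P
    ... | yes u∈P = adj q p , λ {y} y∈P∖Q → let (y∈P , y∉Q) = x∈p∖q⁻ y∈P∖Q in begin
      adj u y ≡⟨ module-adjˡ mQ y∉Q (x∉p∖q⇒x∈q u∉P∖Q u∈P) q∈Q ⟩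
      adj q y ≡⟨ module-adjʳ mP q∉P y∈P p∈P ⟩
      adj q p ∎
    ... | no u∉P = adj u p , λ y∈P∖Q → module-adjʳ mP u∉P (proj₁ (x∈p∖q⁻ y∈P∖Q)) p∈P

  ⊖-isModule : IsModule G P → IsModule G Q → x ∈ P → x ∈ Q → p ∈ P → p ∉ Q → q ∈ Q → q ∉ P
             → IsModule G (P ⊖ Q)
  ⊖-isModule {P} {Q} {x} {p} {q} mP mQ x∈P x∈Q p∈P p∉Q q∈Q q∉P =
    uniform⇒isModule (p , x∈p⊖q⁺ˡ p∈P p∉Q) uniform
    where
    uniform : u ∉ P ⊖ Q → Uniform u (P ⊖ Q)
    uniform {u} u∉P⊖Q with u ∈? P
    ... | yes u∈P = adj q p , [ fromP , fromQ ] ∘ x∈p⊖q⁻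
      where
      u∈Q : u ∈ Q
      u∈Q = Equivalence.to (x∉p⊖q⇒x∈p⇔x∈q u∉P⊖Q) u∈P
      fromP : y ∈ P × y ∉ Q → adj u y ≡ adj q p
      fromP {y} (y∈P , y∉Q) = begin
        adj u y ≡⟨ module-adjˡ mQ y∉Q u∈Q q∈Q ⟩
        adj q y ≡⟨ module-adjʳ mP q∉P y∈P p∈P ⟩
        adj q p ∎
      fromQ : y ∈ Q × y ∉ P → adj u y ≡ adj q p
      fromQ {y} (y∈Q , y∉P) = begin
        adj u y ≡⟨ module-adjˡ mP y∉P u∈P p∈P ⟩
        adj p y ≡⟨ module-adjʳ mQ p∉Q y∈Q q∈Q ⟩
        adj p q ≡⟨ adj-sym p q ⟩
        adj q p ∎
    ... | no u∉P = adj u x , [ (λ (y∈P , _) → module-adjʳ mP u∉P y∈P x∈P)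
                                 , (λ (y∈Q , _) → module-adjʳ mQ u∉Q y∈Q x∈Q) ] ∘ x∈p⊖q⁻
      where
      u∉Q : u ∉ Q
      u∉Q = u∉P ∘ Equivalence.from (x∉p⊖q⇒x∈p⇔x∈q u∉P⊖Q)

module _ (G : Graph) (v : Fin (Graph.n G)) where
  open Graph G using (n)

  private variable
    P Q : Subset n
    a b c w x y : Fin n

  Mod-refl : Mod G v w w
  Mod-refl _ _ _ w∈P = w∈P

  Mod-⊆ : Mod G v w x → Mod G v x ⊆ Mod G v w
  Mod-⊆ x∈Mw y∈Mx P mP v∈P w∈P = y∈Mx P mP v∈P (x∈Mw P mP v∈P w∈P)

  Separates : Fin n → Fin n → Subset n → Set
  Separates w x P = IsModule G P × v ∈ P × w ∈ P × x ∉ P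

  Mod⇒¬separates : Mod G v w x → ¬ Separates w x P
  Mod⇒¬separates x∈Mw (mP , v∈P , w∈P , x∉P) = x∉P (x∈Mw _ mP v∈P w∈P)

  ¬Mod⇒¬¬separates : ¬ Mod G v w x → ¬ ¬ ∃ (Separates w x)
  ¬Mod⇒¬¬separates {x = x} x∉Mw noSeparator = x∉Mw λ P mP v∈P w∈P →
    decidable-stable (x ∈? P) λ x∉P → noSeparator (P , mP , v∈P , w∈P , x∉P)

  ∩-separates : Separates w x P → Separates w y Q → Separates w x (P ∩ Q) × y ∉ P ∩ Q
  ∩-separates {P = P} {Q = Q} (mP , v∈P , w∈P , x∉P) (mQ , v∈Q , w∈Q , y∉Q) =
    ( ∩-isModule G mP mQ v∈P v∈Q , x∈p∩q⁺ (v∈P , v∈Q) , x∈p∩q⁺ (w∈P , w∈Q)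
    , x∉P ∘ proj₁ ∘ x∈p∩q⁻ P Q ) , y∉Q ∘ proj₂ ∘ x∈p∩q⁻ P Q

  separates-exchange : ∀ {N B A} → Separates c a N → b ∉ N → Separates b a B → c ∉ B → Separates a b A
                     → Separates a c (A ∩ ∁ (N ⊖ B))
  separates-exchange {c = c} {a = a} {b = b} {N = N} {B = B} {A = A} (mN , v∈N , c∈N , a∉N) b∉N (mB , v∈B , b∈B , a∉B) c∉B (mA , v∈A , a∈A , b∉A) =
    ∖-isModule G mA mD v∈A v∉D b∈D b∉A , x∈p∖q⁺ v∈A v∉D , x∈p∖q⁺ a∈A a∉D , c∉A∖D
    where
    mD : IsModule G (N ⊖ B)
    mD = ⊖-isModule G mN mB v∈N v∈B c∈N c∉B b∈B b∉N
    v∉D : v ∉ N ⊖ B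
    v∉D = x∉p⊖q (inj₁ (v∈N , v∈B))
    a∉D : a ∉ N ⊖ B
    a∉D = x∉p⊖q (inj₂ (a∉N , a∉B))
    b∈D : b ∈ N ⊖ B
    b∈D = x∈p⊖q⁺ʳ b∈B b∉N
    c∉A∖D : c ∉ A ∩ ∁ (N ⊖ B)
    c∉A∖D c∈A∖D = proj₂ (x∈p∖q⁻ c∈A∖D) (x∈p⊖q⁺ˡ c∈N c∉B)

  Mod-exchange : ¬ Mod G v c b → ¬ Mod G v b a → ¬ Mod G v b c → ¬ Mod G v a b
               → Mod G v a c → Mod G v c a
  Mod-exchange {a = a} b∉Mc a∉Mb c∉Mb b∉Ma c∈Ma N mN v∈N c∈N =
    decidable-stable (a ∈? N) λ a∉N →
    ¬Mod⇒¬¬separates b∉Mc λ (_ , sepC) →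
    ¬Mod⇒¬¬separates a∉Mb λ (_ , sepB₁) →
    ¬Mod⇒¬¬separates c∉Mb λ (_ , sepB₂) →
    ¬Mod⇒¬¬separates b∉Ma λ (_ , sepA) →
    let (sepN′ , b∉N′) = ∩-separates (mN , v∈N , c∈N , a∉N) sepC
        (sepB′ , c∉B′) = ∩-separates sepB₁ sepB₂
    in Mod⇒¬separates c∈Ma (separates-exchange sepN′ b∉N′ sepB′ c∉B′ sepA)

  Prec-negativelyTransitive : ¬ Prec G v a b → ¬ Prec G v b c → ¬ Prec G v a c
  Prec-negativelyTransitive a⊀b b⊀c a≺c@(Mc⊆Ma , Ma⊈Mc) =
    let (Ma⊈Mb , Mb⊈Ma , Mb⊈Mc , Mc⊈Mb) = ⊂-incomparable-between a≺c a⊀b b⊀c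
        a∈Mc = Mod-exchange (Mb⊈Mc ∘ Mod-⊆) (Ma⊈Mb ∘ Mod-⊆) (Mc⊈Mb ∘ Mod-⊆) (Mb⊈Ma ∘ Mod-⊆)
                            (Mc⊆Ma Mod-refl)
    in Ma⊈Mc (Mod-⊆ a∈Mc)

lemma3p13 : (G : Graph) (v : Fin (Graph.n G)) → IsStrictWeakOrder (Prec G v)
lemma3p13 G v = record
  { irrefl = λ _ → ⊂-irrefl ≐-refl
  ; trans = λ _ _ _ a≺b b≺c → ⊂-trans b≺c a≺b
  ; incomparable-trans = λ _ _ _ (a⊀b , b⊀a) (b⊀c , c⊀b) →
      Prec-negativelyTransitive G v a⊀b b⊀c , Prec-negativelyTransitive G v c⊀b b⊀a
  }
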